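{- Let $G$ be the $X$-flip of a path $P$ for a set $X\subseteq V(P)$. For an integer $t\ge 1$, if $|X|\ge 4t-3$, then $G$ has a pivot-minor isomorphic to $\overline{P_t}$.
   Context: For a graph $H$ and $Y\subseteq V(H)$, the $Y$-flip of $H$ is the graph on $V(H)$ obtained by complementing the edge relation between pairs of distinct vertices both in $Y$. $\overline{P_t}$ is the complement of the path on $t$ vertices. Local complementation: $G\ast x:=(V(G),E(G)\triangle\{yz:y,z\in N_G(x),y\neq z\})$; pivoting an edge $uv$: $G\wedge uv:=G\ast u\ast v\ast u$; a pivot-minor is obtained by a (possibly empty) sequence of vertex deletions and pivotings. -}

module Defs where

open import Data.Nat using (ℕ; suc; _+_)
open import Data.Bool using (Bool; true; false; not; _∧_; _∨_; _xor_; if_then_else_)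
open import Data.Fin using (Fin; toℕ; punchIn)
open import Data.Fin.Subset using (Subset)
open import Data.Vec using (lookup)
open import Relation.Nullary.Decidable using (⌊_⌋)
open import Relation.Binary.PropositionalEquality using (_≡_)
open import Function.Bundles using (_↔_; Inverse)
import Data.Fin as F
import Data.Nat as N

Graph : ℕ → Set
Graph n = Fin n → Fin n → Bool

_≢ᵇ_ : ∀ {n} → Fin n → Fin n → Bool
y ≢ᵇ z = not ⌊ y F.≟ z ⌋

path : (n : ℕ) → Graph n
path n i j = ⌊ suc (toℕ i) N.≟ toℕ j ⌋ ∨ ⌊ suc (toℕ j) N.≟ toℕ i ⌋

complement : ∀ {n} → Graph n → Graph n
complement G y z = (y ≢ᵇ z) ∧ not (G y z)

flip : ∀ {n} → Graph n → Subset n → Graph n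
flip G Y y z = (G y z) xor ((y ≢ᵇ z) ∧ lookup Y y ∧ lookup Y z)

localComp : ∀ {n} → Graph n → Fin n → Graph n
localComp G x y z = (G y z) xor ((y ≢ᵇ z) ∧ G x y ∧ G x z)

pivot : ∀ {n} → Graph n → Fin n → Fin n → Graph n
pivot G u v = localComp (localComp (localComp G u) v) u

delete : ∀ {n} → Graph (suc n) → Fin (suc n) → Graph n
delete G v y z = G (punchIn v y) (punchIn v z)

data PivotMinor {m : ℕ} (G : Graph m) : {k : ℕ} → Graph k → Set where
  done  : PivotMinor G G
  del   : ∀ {k} {H : Graph (suc k)} → PivotMinor G H → (v : Fin (suc k)) →
          PivotMinor G (delete H v)
  piv   : ∀ {k} {H : Graph k} → PivotMinor G H → (u v : Fin k) → H u v ≡ true →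
          PivotMinor G (pivot H u v)

record Iso {m n : ℕ} (G : Graph m) (H : Graph n) : Set where
  field
    bij      : Fin m ↔ Fin n
    preserve : ∀ x y → G x y ≡ H (Inverse.to bij x) (Inverse.to bij y)

-- Mark the vertices of the path that lie in X and read the marks as a binary word.
-- Deleting an end vertex, pivoting an edge joining two unmarked vertices, and pivoting
-- two marked vertices at distance 2 or 3 along the path (deleting the two pivot vertices
-- afterwards) each turn a flipped path into a flipped path: the first two just shorten
-- or contract the path, the last toggles the marks of the path-neighbours of the pivot
-- vertices. With these moves a run of marked vertices can be grown greedily from the
-- left, the first vertex of the run costing one mark and each further vertex at most
-- four. So 4t − 3 marks give a run of t marked vertices, and the flip of P_t along all
-- of its vertices is the complement of P_t.
module Submission where

open import Defs
open import Data.Nat using (ℕ; zero; suc; _+_; _*_; _∸_; _≤_; _<_; _≡ᵇ_; z≤n; s≤s; s≤s⁻¹)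
import Data.Nat.Properties as ℕ
open import Data.Bool using (Bool; true; false; not; _∧_; _∨_; _xor_)
open import Data.Bool.Properties
  using (xor-∧-commutativeRing; xor-identityʳ; xor-comm; true-xor; not-involutive; ∨-comm; ∧-comm; T-≡)
open import Data.Fin using (Fin; zero; suc; toℕ; fromℕ; fromℕ<; punchIn)
import Data.Fin.Properties as Fin
open import Data.Fin.Subset using (Subset; ∣_∣)
open import Data.List using (List; []; _∷_; _++_; _∷ʳ_; length; replicate)
import Data.List.Properties as List
open import Data.Vec as V using (Vec; lookup; toList)
import Data.Vec.Properties as Vec
open import Data.Maybe using (just; nothing)
open import Data.Product using (Σ; _×_; _,_)
open import Function using (_∘_)
open import Function.Bundles using (Equivalence)
import Function.Construct.Identity as Identity
open import Level using (0ℓ)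
open import Relation.Binary.PropositionalEquality
open import Relation.Binary.Construct.Closure.ReflexiveTransitive using (Star; ε; _◅_; _◅◅_)
open import Relation.Binary.Construct.Closure.ReflexiveTransitive.Properties using (module StarReasoning)
open import Relation.Nullary using (yes; no)
open import Relation.Nullary.Decidable using (isYes≗does)
open import Tactic.RingSolver.Core.AlmostCommutativeRing using (AlmostCommutativeRing; fromCommutativeRing)
open import Tactic.RingSolver using (solve; solve-∀)
import Data.Nat.Tactic.RingSolver as ℕ-Solver

-- Pivoting

xor-∧-ring : AlmostCommutativeRing 0ℓ 0ℓ
xor-∧-ring = fromCommutativeRing xor-∧-commutativeRing λ { false → just refl ; true → nothing }

localComp-cong : ∀ {n} {H H′ : Graph n} → (∀ x y → H x y ≡ H′ x y) →
  ∀ w x y → localComp H w x y ≡ localComp H′ w x y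
localComp-cong H≗H′ w x y rewrite H≗H′ x y | H≗H′ w x | H≗H′ w y = refl

pivot-cong : ∀ {n} {H H′ : Graph n} → (∀ x y → H x y ≡ H′ x y) →
  ∀ u v x y → pivot H u v x y ≡ pivot H′ u v x y
pivot-cong H≗H′ u v = localComp-cong (localComp-cong (localComp-cong H≗H′ u) v) u

pivot-outside : ∀ {n} (H : Graph n) {u v y z : Fin n} →
  H u v ≡ true → H v u ≡ true → H u u ≡ false → (v ≢ᵇ u) ≡ true →
  (u ≢ᵇ y) ≡ true → (u ≢ᵇ z) ≡ true → (v ≢ᵇ y) ≡ true → (v ≢ᵇ z) ≡ true →
  pivot H u v y z ≡ H y z xor ((y ≢ᵇ z) ∧ ((H u y ∧ H v z) xor (H v y ∧ H u z)))
pivot-outside H {u} {v} {y} {z} huv hvu huu vu uy uz vy vz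
  rewrite huv | hvu | huu | vu | uy | uz | vy | vz
  -- what is left is an identity of the Boolean ring (xor, ∧) in the remaining adjacencies
  with H y z | y ≢ᵇ z | H u y | H u z | H v y | H v z
... | yz | d | uy′ | uz′ | vy′ | vz′ = solve (yz ∷ d ∷ uy′ ∷ uz′ ∷ vy′ ∷ vz′ ∷ []) xor-∧-ring

-- The path on ℕ

≡ᵇ-refl : ∀ a → (a ≡ᵇ a) ≡ true
≡ᵇ-refl zero    = refl
≡ᵇ-refl (suc a) = ≡ᵇ-refl a

≡ᵇ-sym : ∀ a b → (a ≡ᵇ b) ≡ (b ≡ᵇ a)
≡ᵇ-sym zero    zero    = refl
≡ᵇ-sym zero    (suc b) = refl
≡ᵇ-sym (suc a) zero    = refl
≡ᵇ-sym (suc a) (suc b) = ≡ᵇ-sym a b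

<⇒≡ᵇ-false : ∀ {a b} → a < b → (a ≡ᵇ b) ≡ false
<⇒≡ᵇ-false {zero}  {suc b} _         = refl
<⇒≡ᵇ-false {suc a} {suc b} (s≤s a<b) = <⇒≡ᵇ-false a<b

≡ᵇ-true⇒≡ : ∀ {a b} → (a ≡ᵇ b) ≡ true → a ≡ b
≡ᵇ-true⇒≡ {a} {b} e = ℕ.≡ᵇ⇒≡ a b (Equivalence.from T-≡ e)

pathℕ : ℕ → ℕ → Bool
pathℕ a b = (suc a ≡ᵇ b) ∨ (suc b ≡ᵇ a)

pathℕ-sym : ∀ a b → pathℕ a b ≡ pathℕ b a
pathℕ-sym a b = ∨-comm (suc a ≡ᵇ b) (suc b ≡ᵇ a)

pathℕ-irrefl : ∀ a → pathℕ a a ≡ false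
pathℕ-irrefl a rewrite ≡ᵇ-sym (suc a) a | <⇒≡ᵇ-false (ℕ.n<1+n a) = refl

pathℕ-suc : ∀ a → pathℕ a (suc a) ≡ true
pathℕ-suc a rewrite ≡ᵇ-refl a = refl

pathℕ-+ : ∀ n a b → pathℕ (n + a) (n + b) ≡ pathℕ a b
pathℕ-+ zero    a b = refl
pathℕ-+ (suc n) a b = pathℕ-+ n a b

path-toℕ : ∀ {n} (x y : Fin n) → path n x y ≡ pathℕ (toℕ x) (toℕ y)
path-toℕ x y =
  cong₂ _∨_ (isYes≗does (suc (toℕ x) Data.Nat.≟ toℕ y)) (isYes≗does (suc (toℕ y) Data.Nat.≟ toℕ x))

≢ᵇ-toℕ : ∀ {n} (x y : Fin n) → (x ≢ᵇ y) ≡ not (toℕ x ≡ᵇ toℕ y)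
≢ᵇ-toℕ zero    zero    = refl
≢ᵇ-toℕ zero    (suc y) = refl
≢ᵇ-toℕ (suc x) zero    = refl
≢ᵇ-toℕ (suc x) (suc y) with x Data.Fin.≟ y | ≢ᵇ-toℕ x y
... | yes refl | e = e
... | no _     | e = e

≢ᵇ-from-toℕ : ∀ {n} (p q : Fin n) {a b} → toℕ p ≡ a → toℕ q ≡ b → (a ≡ᵇ b) ≡ false → (p ≢ᵇ q) ≡ true
≢ᵇ-from-toℕ p q refl refl a≢b rewrite ≢ᵇ-toℕ p q | a≢b = refl

punchInℕ : ℕ → ℕ → ℕ
punchInℕ zero    b       = suc b
punchInℕ (suc a) zero    = zero
punchInℕ (suc a) (suc b) = suc (punchInℕ a b)

toℕ-punchIn : ∀ {n} (i : Fin (suc n)) (j : Fin n) → toℕ (punchIn i j) ≡ punchInℕ (toℕ i) (toℕ j)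
toℕ-punchIn zero    j       = refl
toℕ-punchIn (suc i) zero    = refl
toℕ-punchIn (suc i) (suc j) = cong suc (toℕ-punchIn i j)

punchInℕ-≡ᵇ : ∀ w a b → (punchInℕ w a ≡ᵇ punchInℕ w b) ≡ (a ≡ᵇ b)
punchInℕ-≡ᵇ zero    a       b       = refl
punchInℕ-≡ᵇ (suc w) zero    zero    = refl
punchInℕ-≡ᵇ (suc w) zero    (suc b) = refl
punchInℕ-≡ᵇ (suc w) (suc a) zero    = refl
punchInℕ-≡ᵇ (suc w) (suc a) (suc b) = punchInℕ-≡ᵇ w a b

punchInℕ-≢ᵇ : ∀ w a → (w ≡ᵇ punchInℕ w a) ≡ false
punchInℕ-≢ᵇ zero    a       = refl
punchInℕ-≢ᵇ (suc w) zero    = refl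
punchInℕ-≢ᵇ (suc w) (suc a) = punchInℕ-≢ᵇ w a

punchInℕ-< : ∀ {a w} → a < w → punchInℕ w a ≡ a
punchInℕ-< {zero}  {suc w} _         = refl
punchInℕ-< {suc a} {suc w} (s≤s a<w) = cong suc (punchInℕ-< a<w)

-- Locally complementing the path at w and deleting w joins the two neighbours of w.
pathℕ-bypass : ∀ w a b →
  pathℕ (punchInℕ w a) (punchInℕ w b) xor (not (a ≡ᵇ b) ∧ pathℕ w (punchInℕ w a) ∧ pathℕ w (punchInℕ w b))
  ≡ pathℕ a b
pathℕ-bypass zero                zero          zero          = refl
pathℕ-bypass zero                zero          (suc b)       = xor-identityʳ _
pathℕ-bypass zero                (suc a)       zero          = xor-identityʳ _
pathℕ-bypass zero                (suc a)       (suc b)       with a ≡ᵇ b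
... | true  = xor-identityʳ _
... | false = xor-identityʳ _
pathℕ-bypass (suc w)             zero          zero          = refl
pathℕ-bypass (suc zero)          zero          (suc b)       = refl
pathℕ-bypass (suc (suc w))       zero          (suc zero)    = refl
pathℕ-bypass (suc (suc w))       zero          (suc (suc b)) = refl
pathℕ-bypass (suc zero)          (suc zero)    zero          = refl
pathℕ-bypass (suc zero)          (suc (suc a)) zero          = refl
pathℕ-bypass (suc (suc zero))    (suc zero)    zero          = refl
pathℕ-bypass (suc (suc (suc w))) (suc zero)    zero          = refl
pathℕ-bypass (suc (suc w))       (suc (suc a)) zero          = ∧-comm _ false
pathℕ-bypass (suc w)             (suc a)       (suc b)       = pathℕ-bypass w a b

-- For u < v, skip u v enumerates ℕ ∖ {u, v} in increasing order.
skip : ℕ → ℕ → ℕ → ℕ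
skip u v a = punchInℕ v (punchInℕ u a)

skip-≡ᵇ : ∀ u v a b → (skip u v a ≡ᵇ skip u v b) ≡ (a ≡ᵇ b)
skip-≡ᵇ u v a b = trans (punchInℕ-≡ᵇ v (punchInℕ u a) (punchInℕ u b)) (punchInℕ-≡ᵇ u a b)

skip-≢ᵇˡ : ∀ {u v} → u < v → ∀ a → (u ≡ᵇ skip u v a) ≡ false
skip-≢ᵇˡ {u} {v} u<v a = begin
  u ≡ᵇ skip u v a              ≡⟨ cong (_≡ᵇ skip u v a) (sym (punchInℕ-< u<v)) ⟩
  punchInℕ v u ≡ᵇ skip u v a   ≡⟨ punchInℕ-≡ᵇ v u (punchInℕ u a) ⟩
  u ≡ᵇ punchInℕ u a            ≡⟨ punchInℕ-≢ᵇ u a ⟩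
  false                        ∎
  where open ≡-Reasoning

skip-≢ᵇʳ : ∀ u v a → (v ≡ᵇ skip u v a) ≡ false
skip-≢ᵇʳ u v a = punchInℕ-≢ᵇ v (punchInℕ u a)

pathℕ-punchIn-neighbour : ∀ {u v} → u < v → ∀ c →
  pathℕ u (punchInℕ u c) ≡ pathℕ u (skip u v c) xor (pathℕ v u ∧ pathℕ v (skip u v c))
pathℕ-punchIn-neighbour {u} {v} u<v c = begin
  pathℕ u (punchInℕ u c)
    ≡⟨ sym (pathℕ-bypass v u (punchInℕ u c)) ⟩
  pathℕ (punchInℕ v u) s xor (not (u ≡ᵇ punchInℕ u c) ∧ pathℕ v (punchInℕ v u) ∧ pathℕ v s)
    ≡⟨ cong₂ (λ w e → pathℕ w s xor (not e ∧ pathℕ v w ∧ pathℕ v s)) (punchInℕ-< u<v) (punchInℕ-≢ᵇ u c) ⟩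
  pathℕ u s xor (pathℕ v u ∧ pathℕ v s)
    ∎
  where
  open ≡-Reasoning
  s = skip u v c

pathℕ-delete-two : ∀ {u v} → u < v → ∀ a b →
  pathℕ a b ≡
    (pathℕ (skip u v a) (skip u v b) xor (not (a ≡ᵇ b) ∧ pathℕ v (skip u v a) ∧ pathℕ v (skip u v b)))
    xor (not (a ≡ᵇ b) ∧ (pathℕ u (skip u v a) xor (pathℕ v u ∧ pathℕ v (skip u v a)))
                      ∧ (pathℕ u (skip u v b) xor (pathℕ v u ∧ pathℕ v (skip u v b))))
pathℕ-delete-two {u} {v} u<v a b = begin
  pathℕ a b
    ≡⟨ sym (pathℕ-bypass u a b) ⟩
  pathℕ a′ b′ xor (not (a ≡ᵇ b) ∧ pathℕ u a′ ∧ pathℕ u b′)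
    ≡⟨ cong₂ (λ p q → p xor (not (a ≡ᵇ b) ∧ q)) (sym bypass-v)
             (cong₂ _∧_ (pathℕ-punchIn-neighbour u<v a) (pathℕ-punchIn-neighbour u<v b)) ⟩
  _ ∎
  where
  open ≡-Reasoning
  a′ = punchInℕ u a
  b′ = punchInℕ u b
  bypass-v : pathℕ (skip u v a) (skip u v b) xor (not (a ≡ᵇ b) ∧ pathℕ v (skip u v a) ∧ pathℕ v (skip u v b))
           ≡ pathℕ a′ b′
  bypass-v = subst (λ e → pathℕ (skip u v a) (skip u v b) xor (not e ∧ pathℕ v (skip u v a) ∧ pathℕ v (skip u v b))
                          ≡ pathℕ a′ b′)
                   (punchInℕ-≡ᵇ u a b) (pathℕ-bypass v a′ b′)

pathℕ-predecessor : ∀ {u y} → pathℕ u y ≡ true → (suc u ≡ᵇ y) ≡ false → suc y ≡ u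
pathℕ-predecessor {u} {y} adj ns = ≡ᵇ-true⇒≡ (subst (λ e → e ∨ (suc y ≡ᵇ u) ≡ true) ns adj)

-- The only path-neighbour of u other than suc u is its predecessor.
no-common-neighbour : ∀ u a b →
  (not (a ≡ᵇ b) ∧ pathℕ u (skip u (suc u) a) ∧ pathℕ u (skip u (suc u) b)) ≡ false
no-common-neighbour u a b with pathℕ u (skip u (suc u) a) in ua | pathℕ u (skip u (suc u) b) in ub
... | false | _     = ∧-comm (not (a ≡ᵇ b)) false
... | true  | false = ∧-comm (not (a ≡ᵇ b)) false
... | true  | true  = cong (λ e → not e ∧ true) (trans (sym (skip-≡ᵇ u (suc u) a b)) same)
  where
  same : (skip u (suc u) a ≡ᵇ skip u (suc u) b) ≡ true
  same = subst (λ z → (skip u (suc u) a ≡ᵇ z) ≡ true)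
               (ℕ.suc-injective (trans (pathℕ-predecessor ua (skip-≢ᵇʳ u (suc u) a))
                                       (sym (pathℕ-predecessor ub (skip-≢ᵇʳ u (suc u) b)))))
               (≡ᵇ-refl (skip u (suc u) a))

xor-∧-contract : ∀ p d uy uz vy vz → (d ∧ uy ∧ uz) ≡ false →
  p xor (d ∧ ((uy ∧ vz) xor (vy ∧ uz))) ≡ (p xor (d ∧ vy ∧ vz)) xor (d ∧ (uy xor vy) ∧ (uz xor vz))
xor-∧-contract p d uy uz vy vz h = begin
  p xor (d ∧ ((uy ∧ vz) xor (vy ∧ uz))) ≡⟨ identity p d uy uz vy vz ⟩
  rhs xor (d ∧ uy ∧ uz)                 ≡⟨ cong (rhs xor_) h ⟩
  rhs xor false                         ≡⟨ xor-identityʳ rhs ⟩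
  rhs                                   ∎
  where
  open ≡-Reasoning
  rhs = (p xor (d ∧ vy ∧ vz)) xor (d ∧ (uy xor vy) ∧ (uz xor vz))
  identity : ∀ p d uy uz vy vz → p xor (d ∧ ((uy ∧ vz) xor (vy ∧ uz)))
    ≡ ((p xor (d ∧ vy ∧ vz)) xor (d ∧ (uy xor vy) ∧ (uz xor vz))) xor (d ∧ uy ∧ uz)
  identity = solve-∀ xor-∧-ring

-- Pivoting the path on an edge and deleting both of its ends contracts the edge.
pathℕ-contract : ∀ u a b →
  pathℕ (skip u (suc u) a) (skip u (suc u) b)
    xor (not (a ≡ᵇ b) ∧ ((pathℕ u (skip u (suc u) a) ∧ pathℕ (suc u) (skip u (suc u) b))
                        xor (pathℕ (suc u) (skip u (suc u) a) ∧ pathℕ u (skip u (suc u) b))))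
  ≡ pathℕ a b
pathℕ-contract u a b rewrite pathℕ-delete-two (ℕ.n<1+n u) a b | pathℕ-sym (suc u) u | pathℕ-suc u =
  xor-∧-contract (pathℕ y z) (not (a ≡ᵇ b)) (pathℕ u y) (pathℕ u z) (pathℕ (suc u) y) (pathℕ (suc u) z)
    (no-common-neighbour u a b)
  where
  y = skip u (suc u) a
  z = skip u (suc u) b

-- Flipped paths

flippedPathℕ : (ℕ → Bool) → ℕ → ℕ → Bool
flippedPathℕ g a b = pathℕ a b xor (not (a ≡ᵇ b) ∧ g a ∧ g b)

flippedPathℕ-sym : ∀ g a b → flippedPathℕ g a b ≡ flippedPathℕ g b a
flippedPathℕ-sym g a b rewrite pathℕ-sym a b | ≡ᵇ-sym a b | ∧-comm (g a) (g b) = refl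

flippedPathℕ-irrefl : ∀ g a → flippedPathℕ g a a ≡ false
flippedPathℕ-irrefl g a rewrite pathℕ-irrefl a | ≡ᵇ-refl a = refl

-- Adjacency of pivot A u v with u and v deleted; vertex a of it is vertex skip u v a of A.
pivotDeleteℕ : (ℕ → ℕ → Bool) → ℕ → ℕ → ℕ → ℕ → Bool
pivotDeleteℕ A u v a b =
  A (skip u v a) (skip u v b)
    xor (not (a ≡ᵇ b) ∧ ((A u (skip u v a) ∧ A v (skip u v b)) xor (A v (skip u v a) ∧ A u (skip u v b))))

toggleNeighbours : ℕ → ℕ → (ℕ → Bool) → ℕ → Bool
toggleNeighbours u v g c = pathℕ u c xor (pathℕ v c xor g c)

pivotDeleteℕ-marked : ∀ g {u v} → u < v → pathℕ v u ≡ false → g u ≡ true → g v ≡ true → ∀ a b →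
  pivotDeleteℕ (flippedPathℕ g) u v a b ≡ flippedPathℕ (toggleNeighbours u v g ∘ skip u v) a b
pivotDeleteℕ-marked g {u} {v} u<v vu gu gv a b
  rewrite pathℕ-delete-two u<v a b | vu | skip-≡ᵇ u v a b
        | skip-≢ᵇˡ u<v a | skip-≢ᵇˡ u<v b | skip-≢ᵇʳ u v a | skip-≢ᵇʳ u v b | gu | gv
  with pathℕ (skip u v a) (skip u v b) | pathℕ u (skip u v a) | pathℕ u (skip u v b)
     | pathℕ v (skip u v a) | pathℕ v (skip u v b) | g (skip u v a) | g (skip u v b) | not (a ≡ᵇ b)
... | yz | uy | uz | vy | vz | gy | gz | d = solve (yz ∷ uy ∷ uz ∷ vy ∷ vz ∷ gy ∷ gz ∷ d ∷ []) xor-∧-ring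

pivotDeleteℕ-unmarked : ∀ g u → g u ≡ false → g (suc u) ≡ false → ∀ a b →
  pivotDeleteℕ (flippedPathℕ g) u (suc u) a b ≡ flippedPathℕ (g ∘ skip u (suc u)) a b
pivotDeleteℕ-unmarked g u gu gv a b
  rewrite sym (pathℕ-contract u a b)
  with pathℕ (skip u (suc u) a) (skip u (suc u) b) | pathℕ u (skip u (suc u) a) | pathℕ u (skip u (suc u) b)
     | pathℕ (suc u) (skip u (suc u) a) | pathℕ (suc u) (skip u (suc u) b)
... | yz | uy | uz | vy | vz
  rewrite skip-≡ᵇ u (suc u) a b | skip-≢ᵇˡ (ℕ.n<1+n u) a | skip-≢ᵇˡ (ℕ.n<1+n u) b
        | skip-≢ᵇʳ u (suc u) a | skip-≢ᵇʳ u (suc u) b | gu | gv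
  with g (skip u (suc u) a) | g (skip u (suc u) b) | not (a ≡ᵇ b)
... | gy | gz | d = solve (yz ∷ uy ∷ uz ∷ vy ∷ vz ∷ gy ∷ gz ∷ d ∷ []) xor-∧-ring

flippedPath : (n : ℕ) → (ℕ → Bool) → Graph n
flippedPath n g x y = flippedPathℕ g (toℕ x) (toℕ y)

flippedPath-pivot : ∀ {n} g {U V y z : Fin n} {a b} → toℕ U < toℕ V →
  toℕ y ≡ skip (toℕ U) (toℕ V) a → toℕ z ≡ skip (toℕ U) (toℕ V) b → flippedPathℕ g (toℕ U) (toℕ V) ≡ true →
  pivot (flippedPath n g) U V y z ≡ pivotDeleteℕ (flippedPathℕ g) (toℕ U) (toℕ V) a b
flippedPath-pivot {n} g {U} {V} {y} {z} {a} {b} u<v y≡ z≡ uv = begin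
  pivot F U V y z
    ≡⟨ pivot-outside F uv (trans (flippedPathℕ-sym g (toℕ V) (toℕ U)) uv) (flippedPathℕ-irrefl g (toℕ U))
         (≢ᵇ-from-toℕ V U refl refl (trans (≡ᵇ-sym (toℕ V) (toℕ U)) (<⇒≡ᵇ-false u<v)))
         (≢ᵇ-from-toℕ U y refl y≡ (skip-≢ᵇˡ u<v a)) (≢ᵇ-from-toℕ U z refl z≡ (skip-≢ᵇˡ u<v b))
         (≢ᵇ-from-toℕ V y refl y≡ (skip-≢ᵇʳ (toℕ U) (toℕ V) a)) (≢ᵇ-from-toℕ V z refl z≡ (skip-≢ᵇʳ (toℕ U) (toℕ V) b)) ⟩
  F y z xor ((y ≢ᵇ z) ∧ ((F U y ∧ F V z) xor (F V y ∧ F U z)))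
    ≡⟨ on-ℕ ⟩
  pivotDeleteℕ (flippedPathℕ g) (toℕ U) (toℕ V) a b
    ∎
  where
  open ≡-Reasoning
  F = flippedPath n g
  on-ℕ : F y z xor ((y ≢ᵇ z) ∧ ((F U y ∧ F V z) xor (F V y ∧ F U z)))
       ≡ pivotDeleteℕ (flippedPathℕ g) (toℕ U) (toℕ V) a b
  on-ℕ rewrite ≢ᵇ-toℕ y z | y≡ | z≡ | skip-≡ᵇ (toℕ U) (toℕ V) a b = refl

record FlippedPathMinor {n₀} (G : Graph n₀) (m : ℕ) (g : ℕ → Bool) : Set where
  constructor flippedPathMinor
  field
    graph   : Graph m
    minor   : PivotMinor G graph
    flipped : ∀ x y → graph x y ≡ flippedPath m g x y

module _ {n₀} {G : Graph n₀} where

  flippedPathMinor-resize : ∀ {m m′ g} → m ≡ m′ → FlippedPathMinor G m g → FlippedPathMinor G m′ g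
  flippedPathMinor-resize refl M = M

  flippedPathMinor-cong : ∀ {m g g′} → (∀ k → k < m → g k ≡ g′ k) →
    FlippedPathMinor G m g → FlippedPathMinor G m g′
  flippedPathMinor-cong g≈g′ (flippedPathMinor H minor H≗) = flippedPathMinor H minor λ x y →
    trans (H≗ x y) (cong₂ (λ p q → pathℕ (toℕ x) (toℕ y) xor (not (toℕ x ≡ᵇ toℕ y) ∧ p ∧ q))
                          (g≈g′ (toℕ x) (Fin.toℕ<n x)) (g≈g′ (toℕ y) (Fin.toℕ<n y)))

  delete-first : ∀ {m g} → FlippedPathMinor G (suc m) g → FlippedPathMinor G m (g ∘ suc)
  delete-first (flippedPathMinor H minor H≗) =
    flippedPathMinor (delete H zero) (del minor zero) λ x y → H≗ (suc x) (suc y)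

  delete-last : ∀ {m g} → FlippedPathMinor G (suc m) g → FlippedPathMinor G m g
  delete-last {m} {g} (flippedPathMinor H minor H≗) =
    flippedPathMinor (delete H (fromℕ m)) (del minor (fromℕ m)) λ x y →
    trans (H≗ (punchIn (fromℕ m) x) (punchIn (fromℕ m) y)) (cong₂ (flippedPathℕ g) (toℕ-last x) (toℕ-last y))
    where
    toℕ-last : ∀ x → toℕ (punchIn (fromℕ m) x) ≡ toℕ x
    toℕ-last x = trans (toℕ-punchIn (fromℕ m) x)
      (trans (cong (λ w → punchInℕ w (toℕ x)) (Fin.toℕ-fromℕ m)) (punchInℕ-< (Fin.toℕ<n x)))

  pivot-delete : ∀ {m g g′} u v → u < v → v < 2 + m → flippedPathℕ g u v ≡ true →
    (∀ a b → pivotDeleteℕ (flippedPathℕ g) u v a b ≡ flippedPathℕ g′ a b) →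
    FlippedPathMinor G (2 + m) g → FlippedPathMinor G m g′
  pivot-delete {m} {g} {g′} u v u<v v<2+m uv pivoted (flippedPathMinor H minor H≗) =
    flippedPathMinor (delete (delete (pivot H U V) V) u′) (del (del (piv minor U V (trans (H≗ U V) F-UV)) V) u′)
      λ x y → begin
        pivot H U V (σ x) (σ y)
          ≡⟨ pivot-cong H≗ U V (σ x) (σ y) ⟩
        pivot (flippedPath (2 + m) g) U V (σ x) (σ y)
          ≡⟨ flippedPath-pivot g (subst₂ _<_ (sym toℕ-U) (sym toℕ-V) u<v) (toℕ-σ x) (toℕ-σ y) F-UV ⟩
        pivotDeleteℕ (flippedPathℕ g) (toℕ U) (toℕ V) (toℕ x) (toℕ y)
          ≡⟨ cong₂ (λ u v → pivotDeleteℕ (flippedPathℕ g) u v (toℕ x) (toℕ y)) toℕ-U toℕ-V ⟩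
        pivotDeleteℕ (flippedPathℕ g) u v (toℕ x) (toℕ y)
          ≡⟨ pivoted (toℕ x) (toℕ y) ⟩
        flippedPathℕ g′ (toℕ x) (toℕ y)
          ∎
    where
    open ≡-Reasoning
    V : Fin (2 + m)
    V = fromℕ< v<2+m
    u′ : Fin (suc m)
    u′ = fromℕ< (ℕ.<-≤-trans u<v (s≤s⁻¹ v<2+m))
    U = punchIn V u′
    σ : Fin m → Fin (2 + m)
    σ x = punchIn V (punchIn u′ x)
    toℕ-V : toℕ V ≡ v
    toℕ-V = Fin.toℕ-fromℕ< v<2+m
    toℕ-U : toℕ U ≡ u
    toℕ-U = trans (toℕ-punchIn V u′) (trans (cong₂ punchInℕ toℕ-V (Fin.toℕ-fromℕ< _)) (punchInℕ-< u<v))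
    toℕ-σ : ∀ x → toℕ (σ x) ≡ skip (toℕ U) (toℕ V) (toℕ x)
    toℕ-σ x = trans (toℕ-punchIn V (punchIn u′ x)) (cong (punchInℕ (toℕ V))
      (trans (toℕ-punchIn u′ x) (cong (λ w → punchInℕ w (toℕ x)) (trans (Fin.toℕ-fromℕ< _) (sym toℕ-U)))))
    F-UV : flippedPathℕ g (toℕ U) (toℕ V) ≡ true
    F-UV = subst₂ (λ a b → flippedPathℕ g a b ≡ true) (sym toℕ-U) (sym toℕ-V) uv

  pivot-marked : ∀ {m g} u v → u < v → v < 2 + m → pathℕ v u ≡ false → g u ≡ true → g v ≡ true →
    FlippedPathMinor G (2 + m) g → FlippedPathMinor G m (toggleNeighbours u v g ∘ skip u v)
  pivot-marked {g = g} u v u<v v<2+m vu gu gv =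
    pivot-delete u v u<v v<2+m edge (pivotDeleteℕ-marked g u<v vu gu gv)
    where
    edge : flippedPathℕ g u v ≡ true
    edge rewrite pathℕ-sym u v | vu | <⇒≡ᵇ-false u<v | gu | gv = refl

  pivot-unmarked : ∀ {m g} u → suc u < 2 + m → g u ≡ false → g (suc u) ≡ false →
    FlippedPathMinor G (2 + m) g → FlippedPathMinor G m (g ∘ skip u (suc u))
  pivot-unmarked {g = g} u v<2+m gu gv =
    pivot-delete u (suc u) (ℕ.n<1+n u) v<2+m edge (pivotDeleteℕ-unmarked g u gu gv)
    where
    edge : flippedPathℕ g u (suc u) ≡ true
    edge rewrite pathℕ-suc u | <⇒≡ᵇ-false (ℕ.n<1+n u) | gu = refl

-- Mark words

-- Positions past the end of a word are unmarked.
mark : List Bool → ℕ → Bool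
mark []      _       = false
mark (b ∷ _) zero    = b
mark (_ ∷ w) (suc k) = mark w k

mark-++ : ∀ p w k → mark (p ++ w) (length p + k) ≡ mark w k
mark-++ []      w k = refl
mark-++ (_ ∷ p) w k = mark-++ p w k

mark-++ˡ : ∀ w s {k} → k < length w → mark (w ++ s) k ≡ mark w k
mark-++ˡ (_ ∷ w) s {zero}  _         = refl
mark-++ˡ (_ ∷ w) s {suc k} (s≤s k<w) = mark-++ˡ w s k<w

mark-replicate : ∀ n {k} → k < n → mark (replicate n true) k ≡ true
mark-replicate (suc n) {zero}  _         = refl
mark-replicate (suc n) {suc k} (s≤s k<n) = mark-replicate n k<n

lookup-mark : ∀ {n} (X : Vec Bool n) i → lookup X i ≡ mark (toList X) (toℕ i)
lookup-mark (b V.∷ X) zero    = refl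
lookup-mark (b V.∷ X) (suc i) = lookup-mark X i

mark-contract : ∀ p s i →
  mark (p ++ false ∷ false ∷ s) (skip (length p + 0) (suc (length p + 0)) i) ≡ mark (p ++ s) i
mark-contract []      s i       = refl
mark-contract (_ ∷ p) s zero    = refl
mark-contract (_ ∷ p) s (suc i) = mark-contract p s i

mark-toggle-++ : ∀ p {w w′} k l →
  (∀ i → toggleNeighbours (suc k) (suc l) (mark w) (skip (suc k) (suc l) i) ≡ mark w′ i) →
  ∀ i → toggleNeighbours (length p + suc k) (length p + suc l) (mark (p ++ w))
          (skip (length p + suc k) (length p + suc l) i)
        ≡ mark (p ++ w′) i
mark-toggle-++ []      k l toggled i       = toggled i
mark-toggle-++ (_ ∷ p) k l toggled zero    rewrite ℕ.+-suc (length p) k | ℕ.+-suc (length p) l = refl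
mark-toggle-++ (_ ∷ p) k l toggled (suc i) = mark-toggle-++ p k l toggled i

length-++-shrink : ∀ (p : List Bool) {w w′} → length w ≡ 2 + length w′ → length (p ++ w) ≡ 2 + length (p ++ w′)
length-++-shrink []      eq = eq
length-++-shrink (_ ∷ p) eq = cong suc (length-++-shrink p eq)

+-<-length-++ : ∀ (p : List Bool) {w} k → k < length w → length p + k < length (p ++ w)
+-<-length-++ []      k k<w = k<w
+-<-length-++ (_ ∷ p) k k<w = s≤s (+-<-length-++ p k k<w)

Realises : ∀ {n₀} → Graph n₀ → List Bool → Set
Realises G w = FlippedPathMinor G (length w) (mark w)

infix 4 _⟶_ _⟶*_

-- pivot₂ and pivot₃ pivot two marked vertices at distance 2 and 3 and delete them,
-- which toggles the marks of their path-neighbours.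
data _⟶_ : List Bool → List Bool → Set where
  drop-head : ∀ b w → b ∷ w ⟶ w
  drop-last : ∀ w b → w ∷ʳ b ⟶ w
  contract  : ∀ p s → p ++ false ∷ false ∷ s ⟶ p ++ s
  pivot₂    : ∀ p a x d s → p ++ a ∷ true ∷ x ∷ true ∷ d ∷ s ⟶ p ++ not a ∷ x ∷ not d ∷ s
  pivot₃    : ∀ p a x y d s →
              p ++ a ∷ true ∷ x ∷ y ∷ true ∷ d ∷ s ⟶ p ++ not a ∷ not x ∷ not y ∷ not d ∷ s

_⟶*_ : List Bool → List Bool → Set
_⟶*_ = Star _⟶_

module _ {n₀} {G : Graph n₀} where

  realises-pivot-marked : ∀ p {w w′} k l → length w ≡ 2 + length w′ → k < l → suc l < length w →
    pathℕ (suc l) (suc k) ≡ false → mark w (suc k) ≡ true → mark w (suc l) ≡ true →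
    (∀ i → toggleNeighbours (suc k) (suc l) (mark w) (skip (suc k) (suc l) i) ≡ mark w′ i) →
    Realises G (p ++ w) → Realises G (p ++ w′)
  realises-pivot-marked p {w} {w′} k l len k<l l<w lk wk wl toggled r =
    flippedPathMinor-cong (λ i _ → mark-toggle-++ p k l toggled i)
      (pivot-marked (length p + suc k) (length p + suc l) (ℕ.+-monoʳ-< (length p) (s≤s k<l))
        (subst (length p + suc l <_) len′ (+-<-length-++ p (suc l) l<w))
        (trans (pathℕ-+ (length p) (suc l) (suc k)) lk)
        (trans (mark-++ p w (suc k)) wk) (trans (mark-++ p w (suc l)) wl)
        (flippedPathMinor-resize len′ r))
    where
    len′ : length (p ++ w) ≡ 2 + length (p ++ w′)
    len′ = length-++-shrink p len

  realises-⟶ : ∀ {w w′} → w ⟶ w′ → Realises G w → Realises G w′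
  realises-⟶ (drop-head b w) r = delete-first r
  realises-⟶ (drop-last w b) r =
    flippedPathMinor-cong (λ k k<w → mark-++ˡ w (b ∷ []) k<w)
      (delete-last (flippedPathMinor-resize (trans (List.length-++ w) (ℕ.+-comm (length w) 1)) r))
  realises-⟶ (contract p s) r =
    flippedPathMinor-cong (λ i _ → mark-contract p s i)
      (pivot-unmarked u (subst₂ _<_ shift len (+-<-length-++ p 1 (s≤s (s≤s z≤n))))
        (mark-++ p w 0) (subst (λ i → mark (p ++ w) i ≡ false) shift (mark-++ p w 1))
        (flippedPathMinor-resize len r))
    where
    w = false ∷ false ∷ s
    -- written length p + 0 so that mark-++ p w 0 types
    u = length p + 0
    shift : length p + 1 ≡ suc u
    shift = ℕ.+-suc (length p) 0
    len : length (p ++ w) ≡ 2 + length (p ++ s)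
    len = length-++-shrink p {w} refl
  realises-⟶ (pivot₂ p a x d s) =
    realises-pivot-marked p 0 2 refl (s≤s z≤n) (s≤s (s≤s (s≤s (s≤s z≤n)))) refl refl refl toggled
    where
    toggled : ∀ i → toggleNeighbours 1 3 (mark (a ∷ true ∷ x ∷ true ∷ d ∷ s)) (skip 1 3 i)
                    ≡ mark (not a ∷ x ∷ not d ∷ s) i
    toggled zero                = refl
    toggled (suc zero)          = not-involutive x
    toggled (suc (suc zero))    = refl
    toggled (suc (suc (suc i))) = refl
  realises-⟶ (pivot₃ p a x y d s) =
    realises-pivot-marked p 0 3 refl (s≤s z≤n) (s≤s (s≤s (s≤s (s≤s (s≤s z≤n))))) refl refl refl toggled
    where
    toggled : ∀ i → toggleNeighbours 1 4 (mark (a ∷ true ∷ x ∷ y ∷ true ∷ d ∷ s)) (skip 1 4 i)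
                    ≡ mark (not a ∷ not x ∷ not y ∷ not d ∷ s) i
    toggled zero                      = refl
    toggled (suc zero)                = refl
    toggled (suc (suc zero))          = refl
    toggled (suc (suc (suc zero)))    = refl
    toggled (suc (suc (suc (suc i)))) = refl

  realises-⟶* : ∀ {w w′} → w ⟶* w′ → Realises G w → Realises G w′
  realises-⟶* ε                r = r
  realises-⟶* (step ◅ steps) r = realises-⟶* steps (realises-⟶ step r)

-- Growing a run of ones

ones : List Bool → ℕ
ones []          = 0
ones (true ∷ w)  = suc (ones w)
ones (false ∷ w) = ones w

replicate-++-∷ : ∀ n (x : Bool) ys → replicate n x ++ x ∷ ys ≡ x ∷ replicate n x ++ ys
replicate-++-∷ zero    x ys = refl
replicate-++-∷ (suc n) x ys = cong (x ∷_) (replicate-++-∷ n x ys)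

replicate-++-replicate : ∀ j k (L : List Bool) →
  replicate j true ++ replicate k true ++ L ≡ replicate (k + j) true ++ L
replicate-++-replicate j zero    L = refl
replicate-++-replicate j (suc k) L =
  trans (replicate-++-∷ j true _) (cong (true ∷_) (replicate-++-replicate j k L))

contract-after : ∀ p q s → p ++ q ++ false ∷ false ∷ s ⟶ p ++ q ++ s
contract-after p q s = subst₂ _⟶_ (List.++-assoc p q _) (List.++-assoc p q s) (contract (p ++ q) s)

drop-suffix : ∀ w s → w ++ s ⟶* w
drop-suffix w []      = subst (_⟶* w) (sym (List.++-identityʳ w)) ε
drop-suffix w (b ∷ s) = subst (_⟶* w) (List.∷ʳ-++ w b s) (drop-suffix (w ∷ʳ b) s ◅◅ (drop-last w b ◅ ε))

drop-run : ∀ d t → replicate (d + t) true ⟶* replicate t true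
drop-run zero    t = ε
drop-run (suc d) t = drop-head true _ ◅ drop-run d t

run-shrink : ∀ {t j} → t ≤ j → ∀ L → replicate j true ++ L ⟶* replicate t true
run-shrink {t} {j} t≤j L = drop-suffix (replicate j true) L
  ◅◅ subst (λ n → replicate n true ⟶* replicate t true) (ℕ.m∸n+n≡m t≤j) (drop-run (j ∸ t) t)

4t≤4j+c⇒t≤j : ∀ {t j c} → c ≤ 3 → 4 * t ≤ 4 * j + c → t ≤ j
4t≤4j+c⇒t≤j {t} {j} {c} c≤3 h = s≤s⁻¹ (ℕ.*-cancelˡ-< 4 t (suc j) (begin-strict
  4 * t     ≤⟨ h ⟩
  4 * j + c ≤⟨ ℕ.+-monoʳ-≤ (4 * j) c≤3 ⟩
  4 * j + 3 ≡⟨ ℕ.+-comm (4 * j) 3 ⟩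
  3 + 4 * j <⟨ ℕ.n<1+n (3 + 4 * j) ⟩
  4 + 4 * j ≡⟨ sym (ℕ.*-suc 4 j) ⟩
  4 * suc j ∎))
  where open ℕ.≤-Reasoning

-- A state is a run of j ones followed by one of the prefixes ε, 0, 01, 010, 011, 0110
-- and a tail L. Every move lengthening the run by k loses at most 4k ones, so the
-- budget 4t ≤ 4j + ones (prefix ++ L) is preserved; when L is too short to move on,
-- the budget already forces t ≤ j.
module _ (t : ℕ) where
  open StarReasoning _⟶_

  1^ : ℕ → List Bool
  1^ j = replicate j true

  finish : ∀ j L {c} → c ≤ 3 → 4 * t ≤ 4 * j + c → 1^ j ++ L ⟶* 1^ t
  finish j L c≤3 h = run-shrink {t} {j} (4t≤4j+c⇒t≤j c≤3 h) L

  4t≤4j+x⇒4t≤4[k+j]+y : ∀ {j} k {x y} → 4 * t ≤ 4 * j + x → x ≤ 4 * k + y → 4 * t ≤ 4 * (k + j) + y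
  4t≤4j+x⇒4t≤4[k+j]+y {j} k {x} {y} h x≤ =
    ℕ.≤-trans h (ℕ.≤-trans (ℕ.+-monoʳ-≤ (4 * j) x≤) (ℕ.≤-reflexive (regroup j k y)))
    where
    regroup : ∀ j k y → 4 * j + (4 * k + y) ≡ 4 * (k + j) + y
    regroup = ℕ-Solver.solve-∀

  run      : ∀ j L → 4 * t ≤ 4 * j + ones L → 1^ j ++ L ⟶* 1^ t
  run₀     : ∀ j L → 4 * t ≤ 4 * j + ones (false ∷ L) → 1^ j ++ false ∷ L ⟶* 1^ t
  run₀₁    : ∀ j L → 4 * t ≤ 4 * j + ones (false ∷ true ∷ L) → 1^ j ++ false ∷ true ∷ L ⟶* 1^ t
  run₀₁₀   : ∀ j L → 4 * t ≤ 4 * j + ones (false ∷ true ∷ false ∷ L) →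
             1^ j ++ false ∷ true ∷ false ∷ L ⟶* 1^ t
  run₀₁₁   : ∀ j L → 4 * t ≤ 4 * j + ones (false ∷ true ∷ true ∷ L) →
             1^ j ++ false ∷ true ∷ true ∷ L ⟶* 1^ t
  run₀₁₁₀  : ∀ j L → 4 * t ≤ 4 * j + ones (false ∷ true ∷ true ∷ false ∷ L) →
             1^ j ++ false ∷ true ∷ true ∷ false ∷ L ⟶* 1^ t

  run j []          h = finish j [] z≤n h
  run j (true ∷ L)  h = begin
    1^ j ++ true ∷ L  ≡⟨ replicate-++-∷ j true L ⟩
    1^ (suc j) ++ L   ⟶*⟨ run (suc j) L (4t≤4j+x⇒4t≤4[k+j]+y 1 h (ℕ.m≤n+m _ 3)) ⟩
    1^ t              ∎
  run j (false ∷ L) h = run₀ j L h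

  run₀ j []          h = finish j _ z≤n h
  run₀ j (false ∷ L) h = contract (1^ j) L ◅ run j L h
  run₀ j (true ∷ L)  h = run₀₁ j L h

  run₀₁ j []          h = finish j _ (s≤s z≤n) h
  run₀₁ j (false ∷ L) h = run₀₁₀ j L h
  run₀₁ j (true ∷ L)  h = run₀₁₁ j L h

  run₀₁₀ j []                 h = finish j _ (s≤s z≤n) h
  run₀₁₀ j (false ∷ L)        h = contract-after (1^ j) (false ∷ true ∷ []) L ◅ run₀₁ j L h
  run₀₁₀ j (true ∷ [])        h = finish j _ (s≤s (s≤s z≤n)) h
  run₀₁₀ j (true ∷ true ∷ L)  h = begin
    1^ j ++ false ∷ true ∷ false ∷ true ∷ true ∷ L  ⟶⟨ pivot₂ (1^ j) false false true L ⟩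
    1^ j ++ true ∷ false ∷ false ∷ L                ≡⟨ replicate-++-∷ j true _ ⟩
    1^ (suc j) ++ false ∷ false ∷ L                 ⟶⟨ contract (1^ (suc j)) L ⟩
    1^ (suc j) ++ L
      ⟶*⟨ run (suc j) L (4t≤4j+x⇒4t≤4[k+j]+y 1 h (ℕ.m≤n+m _ 1)) ⟩
    1^ t ∎
  run₀₁₀ j (true ∷ false ∷ L) h = begin
    1^ j ++ false ∷ true ∷ false ∷ true ∷ false ∷ L ⟶⟨ pivot₂ (1^ j) false false false L ⟩
    1^ j ++ true ∷ false ∷ true ∷ L                 ≡⟨ replicate-++-∷ j true _ ⟩
    1^ (suc j) ++ false ∷ true ∷ L
      ⟶*⟨ run₀₁ (suc j) L (4t≤4j+x⇒4t≤4[k+j]+y 1 h (ℕ.m≤n+m _ 3)) ⟩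
    1^ t ∎

  run₀₁₁ j []                 h = finish j _ (s≤s (s≤s z≤n)) h
  run₀₁₁ j (false ∷ L)        h = run₀₁₁₀ j L h
  run₀₁₁ j (true ∷ [])        h = finish j _ ℕ.≤-refl h
  run₀₁₁ j (true ∷ true ∷ L)  h = begin
    1^ j ++ false ∷ true ∷ true ∷ true ∷ true ∷ L   ⟶⟨ pivot₂ (1^ j) false true true L ⟩
    1^ j ++ 1^ 2 ++ false ∷ L                       ≡⟨ replicate-++-replicate j 2 _ ⟩
    1^ (2 + j) ++ false ∷ L
      ⟶*⟨ run₀ (2 + j) L (4t≤4j+x⇒4t≤4[k+j]+y 2 h (ℕ.m≤n+m _ 4)) ⟩
    1^ t ∎
  run₀₁₁ j (true ∷ false ∷ L) h = begin
    1^ j ++ false ∷ true ∷ true ∷ true ∷ false ∷ L  ⟶⟨ pivot₂ (1^ j) false true false L ⟩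
    1^ j ++ 1^ 3 ++ L                               ≡⟨ replicate-++-replicate j 3 _ ⟩
    1^ (3 + j) ++ L
      ⟶*⟨ run (3 + j) L (4t≤4j+x⇒4t≤4[k+j]+y 3 h (ℕ.m≤n+m _ 9)) ⟩
    1^ t ∎

  run₀₁₁₀ j []                 h = finish j _ (s≤s (s≤s z≤n)) h
  run₀₁₁₀ j (false ∷ L)        h = contract-after (1^ j) (false ∷ true ∷ true ∷ []) L ◅ run₀₁₁ j L h
  run₀₁₁₀ j (true ∷ [])        h = finish j _ ℕ.≤-refl h
  run₀₁₁₀ j (true ∷ true ∷ L)  h = begin
    1^ j ++ false ∷ true ∷ true ∷ false ∷ true ∷ true ∷ L  ⟶⟨ pivot₃ (1^ j) false true false true L ⟩
    1^ j ++ true ∷ false ∷ true ∷ false ∷ L                ≡⟨ replicate-++-∷ j true _ ⟩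
    1^ (suc j) ++ false ∷ true ∷ false ∷ L
      ⟶*⟨ run₀₁₀ (suc j) L (4t≤4j+x⇒4t≤4[k+j]+y 1 h (ℕ.m≤n+m _ 1)) ⟩
    1^ t ∎
  run₀₁₁₀ j (true ∷ false ∷ L) h = begin
    1^ j ++ false ∷ true ∷ true ∷ false ∷ true ∷ false ∷ L ⟶⟨ pivot₃ (1^ j) false true false false L ⟩
    1^ j ++ true ∷ false ∷ true ∷ true ∷ L                 ≡⟨ replicate-++-∷ j true _ ⟩
    1^ (suc j) ++ false ∷ true ∷ true ∷ L
      ⟶*⟨ run₀₁₁ (suc j) L (4t≤4j+x⇒4t≤4[k+j]+y 1 h (ℕ.m≤n+m _ 3)) ⟩
    1^ t ∎

  reduces-to-run : ∀ w → 4 * t ≤ 3 + ones w → w ⟶* 1^ t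
  reduces-to-run []          h = finish 0 [] ℕ.≤-refl h
  reduces-to-run (false ∷ w) h = drop-head false w ◅ reduces-to-run w h
  reduces-to-run (true ∷ w)  h = run 1 w h

∣∣≡ones : ∀ {n} (X : Subset n) → ∣ X ∣ ≡ ones (toList X)
∣∣≡ones V.[]          = refl
∣∣≡ones (true V.∷ X)  = cong suc (∣∣≡ones X)
∣∣≡ones (false V.∷ X) = ∣∣≡ones X

realises-flip : ∀ n (X : Subset n) → Realises (flip (path n) X) (toList X)
realises-flip n X =
  flippedPathMinor-resize (sym (Vec.length-toList X)) (flippedPathMinor (flip (path n) X) done flip≗)
  where
  flip≗ : ∀ x y → flip (path n) X x y ≡ flippedPath n (mark (toList X)) x y
  flip≗ x y = cong₂ _xor_ (path-toℕ x y) (cong₂ _∧_ (≢ᵇ-toℕ x y) (cong₂ _∧_ (lookup-mark X x) (lookup-mark X y)))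

flippedPathℕ-marked : ∀ {g} a b → g a ≡ true → g b ≡ true →
  flippedPathℕ g a b ≡ not (a ≡ᵇ b) ∧ not (pathℕ a b)
flippedPathℕ-marked a b ga gb rewrite ga | gb with a ≡ᵇ b in a≡b
... | true  =
  trans (xor-identityʳ (pathℕ a b)) (subst (λ c → pathℕ a c ≡ false) (≡ᵇ-true⇒≡ a≡b) (pathℕ-irrefl a))
... | false = trans (xor-comm (pathℕ a b) true) (true-xor (pathℕ a b))

complement-of-run : ∀ {n₀} {G : Graph n₀} t → Realises G (replicate t true) →
  Σ (Graph t) λ H → PivotMinor G H × Iso H (complement (path t))
complement-of-run t r with flippedPathMinor-resize (List.length-replicate t) r
... | flippedPathMinor H minor H≗ = H , minor , record { bij = Identity.↔-id (Fin t) ; preserve = preserve }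
  where
  open ≡-Reasoning
  preserve : ∀ x y → H x y ≡ complement (path t) x y
  preserve x y = begin
    H x y
      ≡⟨ H≗ x y ⟩
    flippedPathℕ (mark (replicate t true)) (toℕ x) (toℕ y)
      ≡⟨ flippedPathℕ-marked {mark (replicate t true)} (toℕ x) (toℕ y)
           (mark-replicate t (Fin.toℕ<n x)) (mark-replicate t (Fin.toℕ<n y)) ⟩
    not (toℕ x ≡ᵇ toℕ y) ∧ not (pathℕ (toℕ x) (toℕ y))
      ≡⟨ sym (cong₂ (λ d p → d ∧ not p) (≢ᵇ-toℕ x y) (path-toℕ x y)) ⟩
    complement (path t) x y
      ∎

corollary4p6 : (n : ℕ) (X : Subset n) (t : ℕ) → 1 ≤ t → 4 * t ∸ 3 ≤ ∣ X ∣ →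
    Σ (Graph t) (λ H → PivotMinor (flip (path n) X) H × Iso H (complement (path t)))
corollary4p6 n X t _ 4t∸3≤∣X∣ =
  complement-of-run t (realises-⟶* (reduces-to-run t (toList X) 4t≤3+∣X∣) (realises-flip n X))
  where
  4t≤3+∣X∣ : 4 * t ≤ 3 + ones (toList X)
  4t≤3+∣X∣ = ℕ.≤-trans (ℕ.m≤n+m∸n (4 * t) 3) (ℕ.+-monoʳ-≤ 3 (subst (4 * t ∸ 3 ≤_) (∣∣≡ones X) 4t∸3≤∣X∣))
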